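{- Let $k\ge2$ and $n>2^k$ be integers, $c=2^k-2$, suppose $d=\gcd(c,n-1)>1$, let $w=(n-1)/d$, and define $y$ on $V=\{0,\dots,n-1\}$ by $y_v=0$ if $v$ is a multiple of $d$ and $y_v=\frac{1}{w(d-1)}$ otherwise. Let $[u\oplus\ell]_{n-1}$ and $[v\oplus s]_{n-1}$ be two disjoint intervals. Then $$y([u\oplus\ell]_{n-1})+y([v\oplus s]_{n-1})\le y([u\oplus(\ell+s+1)]_{n-1}).$$
   Context: Interval notation: for integers $u,v$ and $r\ge1$, $[u,v]_r=\{z\bmod r:u\le z\le v\}$ if $u\le v$ and $\emptyset$ otherwise, and $[v\oplus\ell]_r=[v,v+\ell-1]_r$. For $S\subseteq V$, $y(S)=\sum_{v\in S}y_v$. -}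

module Defs where

open import Data.Nat using (ℕ; zero; suc; _+_; _*_; _∸_)
open import Data.Nat.Divisibility using (_∣?_)
open import Data.Nat.DivMod using (_mod_)
open import Data.Nat.Base using (_/_)
open import Data.Fin using (Fin; toℕ) renaming (zero to fzero; suc to fsuc)
open import Data.Fin.Subset using (Subset; ⊥; ⁅_⁆; _∪_; _∩_; Empty)
open import Data.List using (foldr; upTo)
open import Data.Vec using ([]; _∷_)
open import Data.Bool using (true; false)
open import Data.Integer using (+_)
open import Data.Rational using (ℚ; 0ℚ) renaming (_+_ to _+ℚ_; _/_ to _/ℚ_)
open import Relation.Nullary using (yes; no)

-- [u ⊕ ℓ]_r = { z mod r : u ≤ z ≤ u + ℓ - 1 } as a subset of ℤ_r = Fin r
-- (built literally as the union of the singletons {(u+i) mod r}, i < ℓ).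
interval : (r u ℓ : ℕ) → Subset r
interval zero    u ℓ = []
interval (suc r) u ℓ = foldr (λ i S → ⁅ (u + i) mod (suc r) ⁆ ∪ S) ⊥ (upTo ℓ)

Disjoint : {r : ℕ} → Subset r → Subset r → Set
Disjoint S T = Empty (S ∩ T)

ySum : {r : ℕ} → (Fin r → ℚ) → Subset r → ℚ
ySum {zero}  y []            = 0ℚ
ySum {suc r} y (true  ∷ S)   = y fzero +ℚ ySum (λ i → y (fsuc i)) S
ySum {suc r} y (false ∷ S)   = ySum (λ i → y (fsuc i)) S

-- 1/m as a rational (only used with m ≠ 0; the value at 0 is a dummy).
recip : ℕ → ℚ
recip zero    = 0ℚ
recip (suc m) = (+ 1) /ℚ (suc m)

-- m / d for natural numbers (only used with d ≠ 0; dummy value at 0).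
divN : ℕ → ℕ → ℕ
divN m zero    = 0
divN m (suc d) = m / suc d

-- The weight function y on ℤ_{n-1} (vertices 0..n-2 of V; intervals are
-- taken mod n-1): y_v = 0 if d ∣ v, else 1/(w(d-1)) with w = (n-1)/d.
yW : (n d : ℕ) → Fin (n ∸ 1) → ℚ
yW n d v with d ∣? toℕ v
... | yes _ = 0ℚ
... | no  _ = recip (divN (n ∸ 1) d * (d ∸ 1))

-- Because d divides n − 1, the residue of a mod n − 1 is a multiple of d exactly when a
-- is, so an arc of length L ≤ n − 1 weighs (L − #multiples of d in the arc)/(w(d − 1)).
-- Any d consecutive integers contain exactly one multiple of d, hence a window of
-- length s + 1 contains at most ⌊s/d⌋ + 1 multiples and a window of length s at least
-- ⌊s/d⌋; so the arc of length s + 1 starting right after [u ⊕ ℓ] is at least as heavy as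
-- [v ⊕ s], and together with [u ⊕ ℓ] it forms [u ⊕ (ℓ + s + 1)]. If ℓ + s + 1 ≥ n − 1
-- that arc is the whole cycle, and the claim is monotonicity of the nonnegative weight.
module Submission where

open import Defs
open import Data.Nat using (ℕ; _+_; _∸_; _^_; _≤_; _<_)
open import Data.Nat.GCD using (gcd; gcd[m,n]∣n)
open import Data.Rational using () renaming (_+_ to _+ℚ_; _≤_ to _≤ℚ_)

open import Algebra.Bundles using (CommutativeMonoid)
open import Data.Bool.Base using (true; false)
open import Data.Empty using (⊥-elim)
open import Data.Fin.Base using (Fin; toℕ) renaming (zero to fzero; suc to fsuc)
open import Data.Fin.Properties using (toℕ-fromℕ<; toℕ-injective; toℕ<n)
open import Data.Fin.Subset using (Subset; ⊥; ⁅_⁆; _∪_; _∩_; Empty; _∈_; _⊆_)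
open import Data.Fin.Subset.Properties
  using (∉⊥; x∈⁅x⁆; x∈⁅y⁆⇒x≡y; x∈p∩q⁺; x∈p∩q⁻; x∈p∪q⁺; x∈p∪q⁻; ∪-assoc; ∪-identityˡ;
         drop-∷-Empty; drop-∷-⊆)
open import Data.List.Base using (foldr; applyUpTo)
open import Data.Nat.Base using (zero; suc; z≤n; s≤s; z<s; s<s; s<s⁻¹; pred; _*_; _%_; _/_; NonZero; >-nonZero)
open import Data.Nat.DivMod
  using (_mod_; m≡m%n+[m/n]*n; m%n<n; m%n%n≡m%n; %-distribˡ-+; [m+n]%n≡m%n; m<n⇒m%n≡m; m∣n⇒o%n%m≡o%m)
open import Data.Nat.Divisibility
  using (_∣_; _∣?_; _∣0; ∣-refl; n∣m*n; ∣m+n∣m⇒∣n; ∣m∣n⇒∣m+n; >⇒∤; m%n≡0⇒n∣m; n∣m⇒m%n≡0)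
import Data.Nat.Properties as ℕ
open import Data.Product.Base using (∃-syntax; _×_; _,_)
open import Data.Rational.Base using (ℚ; 0ℚ)
import Data.Rational.Properties as ℚ
open import Data.Sum.Base using (inj₁; inj₂)
open import Data.Vec.Base using ([]; _∷_; here)
open import Function.Base using (_∘_; id)
open import Relation.Nullary using (yes; no; ¬_)
open import Relation.Binary.PropositionalEquality using (_≡_; refl; sym; trans; cong; cong₂; subst; module ≡-Reasoning)

open import Algebra.Properties.Monoid.Mult ℚ.+-0-monoid using () renaming (_×_ to _·_)
import Algebra.Properties.CommutativeSemigroup ℕ.+-commutativeSemigroup as ℕ+
import Algebra.Properties.CommutativeSemigroup (CommutativeMonoid.commutativeSemigroup ℚ.+-0-commutativeMonoid) as ℚ+

p≤q+p : ∀ {p q} → 0ℚ ≤ℚ q → p ≤ℚ q +ℚ p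
p≤q+p {p} {q} 0≤q = subst (_≤ℚ q +ℚ p) (ℚ.+-identityˡ p) (ℚ.+-monoˡ-≤ p 0≤q)

·-nonNeg : ∀ {α} → 0ℚ ≤ℚ α → ∀ n → 0ℚ ≤ℚ n · α
·-nonNeg 0≤α zero    = ℚ.≤-refl
·-nonNeg 0≤α (suc n) = ℚ.≤-trans (·-nonNeg 0≤α n) (p≤q+p 0≤α)

·-monoˡ-≤ : ∀ {α} → 0ℚ ≤ℚ α → ∀ {m n} → m ≤ n → m · α ≤ℚ n · α
·-monoˡ-≤ 0≤α {n = n} z≤n = ·-nonNeg 0≤α n
·-monoˡ-≤ {α} 0≤α (s≤s m≤n) = ℚ.+-monoʳ-≤ α (·-monoˡ-≤ 0≤α m≤n)

ySum-⊥ : ∀ {r} (y : Fin r → ℚ) → ySum y ⊥ ≡ 0ℚ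
ySum-⊥ {zero}  y = refl
ySum-⊥ {suc r} y = ySum-⊥ (y ∘ fsuc)

ySum-⁅⁆ : ∀ {r} (y : Fin r → ℚ) x → ySum y ⁅ x ⁆ ≡ y x
ySum-⁅⁆ {suc r} y fzero    = trans (cong (y fzero +ℚ_) (ySum-⊥ (y ∘ fsuc))) (ℚ.+-identityʳ _)
ySum-⁅⁆ {suc r} y (fsuc x) = ySum-⁅⁆ (y ∘ fsuc) x

ySum-∪ : ∀ {r} (y : Fin r → ℚ) (S T : Subset r) → Empty (S ∩ T) →
         ySum y (S ∪ T) ≡ ySum y S +ℚ ySum y T
ySum-∪ {zero}  y []          []          _ = sym (ℚ.+-identityʳ 0ℚ)
ySum-∪ {suc r} y (true ∷ S)  (true ∷ T)  S∩T-empty = ⊥-elim (S∩T-empty (fzero , here))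
ySum-∪ {suc r} y (true ∷ S)  (false ∷ T) S∩T-empty =
  trans (cong (y fzero +ℚ_) (ySum-∪ (y ∘ fsuc) S T (drop-∷-Empty S∩T-empty)))
        (sym (ℚ.+-assoc (y fzero) (ySum (y ∘ fsuc) S) (ySum (y ∘ fsuc) T)))
ySum-∪ {suc r} y (false ∷ S) (true ∷ T)  S∩T-empty =
  trans (cong (y fzero +ℚ_) (ySum-∪ (y ∘ fsuc) S T (drop-∷-Empty S∩T-empty)))
        (ℚ+.x∙yz≈y∙xz (y fzero) (ySum (y ∘ fsuc) S) (ySum (y ∘ fsuc) T))
ySum-∪ {suc r} y (false ∷ S) (false ∷ T) S∩T-empty = ySum-∪ (y ∘ fsuc) S T (drop-∷-Empty S∩T-empty)

ySum-mono-⊆ : ∀ {r} (y : Fin r → ℚ) → (∀ x → 0ℚ ≤ℚ y x) → ∀ {S T} → S ⊆ T → ySum y S ≤ℚ ySum y T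
ySum-mono-⊆ {zero}  y y≥0 {[]}        {[]}        _   = ℚ.≤-refl
ySum-mono-⊆ {suc r} y y≥0 {true ∷ S}  {true ∷ T}  S⊆T =
  ℚ.+-monoʳ-≤ (y fzero) (ySum-mono-⊆ (y ∘ fsuc) (y≥0 ∘ fsuc) (drop-∷-⊆ S⊆T))
ySum-mono-⊆ {suc r} y y≥0 {true ∷ S}  {false ∷ T} S⊆T with S⊆T here
... | ()
ySum-mono-⊆ {suc r} y y≥0 {false ∷ S} {true ∷ T}  S⊆T =
  ℚ.≤-trans (ySum-mono-⊆ (y ∘ fsuc) (y≥0 ∘ fsuc) (drop-∷-⊆ S⊆T)) (p≤q+p (y≥0 fzero))
ySum-mono-⊆ {suc r} y y≥0 {false ∷ S} {false ∷ T} S⊆T =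
  ySum-mono-⊆ (y ∘ fsuc) (y≥0 ∘ fsuc) (drop-∷-⊆ S⊆T)

[m+n]%o≡m%o⇒o∣n : ∀ m {n o} .{{_ : NonZero o}} → (m + n) % o ≡ m % o → o ∣ n
[m+n]%o≡m%o⇒o∣n m {n} {o} eq = ∣m+n∣m⇒∣n (subst (o ∣_) (sym q*o+n≡q′*o) (n∣m*n ((m + n) / o))) (n∣m*n (m / o))
  where
  open ≡-Reasoning
  q*o+n≡q′*o : m / o * o + n ≡ (m + n) / o * o
  q*o+n≡q′*o = ℕ.+-cancelˡ-≡ (m % o) _ _ (begin
    m % o + (m / o * o + n)        ≡⟨ ℕ.+-assoc (m % o) (m / o * o) n ⟨
    m % o + m / o * o + n          ≡⟨ cong (_+ n) (m≡m%n+[m/n]*n m o) ⟨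
    m + n                          ≡⟨ m≡m%n+[m/n]*n (m + n) o ⟩
    (m + n) % o + (m + n) / o * o  ≡⟨ cong (_+ (m + n) / o * o) eq ⟩
    m % o + (m + n) / o * o        ∎)

-- The arc [a ⊕ L] of ℤ_r, in the recursive shape that the foldr defining `interval` unfolds to.
arc : (r : ℕ) .{{_ : NonZero r}} → ℕ → ℕ → Subset r
arc r a zero    = ⊥
arc r a (suc L) = ⁅ a mod r ⁆ ∪ arc r (suc a) L

interval≡arc : ∀ r u ℓ → interval (suc r) u ℓ ≡ arc (suc r) u ℓ
interval≡arc r u ℓ = trans (foldr≡arc id 0 ℓ (λ _ → refl)) (cong (λ a → arc (suc r) a ℓ) (ℕ.+-identityʳ u))
  where
  foldr≡arc : ∀ (f : ℕ → ℕ) k L → (∀ i → f i ≡ k + i) →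
              foldr (λ i S → ⁅ (u + i) mod suc r ⁆ ∪ S) ⊥ (applyUpTo f L) ≡ arc (suc r) (u + k) L
  foldr≡arc f k zero    _      = refl
  foldr≡arc f k (suc L) f≗k+ = cong₂ _∪_
    (cong (λ i → ⁅ (u + i) mod suc r ⁆) (trans (f≗k+ 0) (ℕ.+-identityʳ k)))
    (trans (foldr≡arc (f ∘ suc) (suc k) L (λ i → trans (f≗k+ (suc i)) (ℕ.+-suc k i)))
           (cong (λ a → arc (suc r) a L) (ℕ.+-suc u k)))

module _ {r : ℕ} .{{_ : NonZero r}} where

  toℕ-mod : ∀ a → toℕ (a mod r) ≡ a % r
  toℕ-mod a = toℕ-fromℕ< (m%n<n a r)

  ∈-arc⁻ : ∀ {a L x} → x ∈ arc r a L → ∃[ i ] i < L × toℕ x ≡ (a + i) % r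
  ∈-arc⁻ {a} {zero}      x∈ = ⊥-elim (∉⊥ x∈)
  ∈-arc⁻ {a} {suc L} {x} x∈ with x∈p∪q⁻ ⁅ a mod r ⁆ (arc r (suc a) L) x∈
  ... | inj₁ x∈⁅a⁆ = 0 , z<s ,
        trans (cong toℕ (x∈⁅y⁆⇒x≡y _ x∈⁅a⁆)) (trans (toℕ-mod a) (cong (_% r) (sym (ℕ.+-identityʳ a))))
  ... | inj₂ x∈arc with ∈-arc⁻ x∈arc
  ...   | i , i<L , x≡ = suc i , s<s i<L , trans x≡ (cong (_% r) (sym (ℕ.+-suc a i)))

  ∈-arc⁺ : ∀ {a L x} i → i < L → toℕ x ≡ (a + i) % r → x ∈ arc r a L
  ∈-arc⁺ {a} {suc L} {x} zero    _   x≡ = x∈p∪q⁺ (inj₁ (subst (_∈ ⁅ a mod r ⁆) (sym x≡a) (x∈⁅x⁆ _)))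
    where
    x≡a : x ≡ a mod r
    x≡a = toℕ-injective (trans x≡ (trans (cong (_% r) (ℕ.+-identityʳ a)) (sym (toℕ-mod a))))
  ∈-arc⁺ {a} {suc L}     (suc i) i<L x≡ =
    x∈p∪q⁺ (inj₂ (∈-arc⁺ i (s<s⁻¹ i<L) (trans x≡ (cong (_% r) (ℕ.+-suc a i)))))

  arc-+ : ∀ a L₁ L₂ → arc r a (L₁ + L₂) ≡ arc r a L₁ ∪ arc r (a + L₁) L₂
  arc-+ a zero     L₂ = sym (trans (∪-identityˡ _) (cong (λ b → arc r b L₂) (ℕ.+-identityʳ a)))
  arc-+ a (suc L₁) L₂ = begin
    ⁅ a mod r ⁆ ∪ arc r (suc a) (L₁ + L₂)                     ≡⟨ cong (⁅ a mod r ⁆ ∪_) (arc-+ (suc a) L₁ L₂) ⟩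
    ⁅ a mod r ⁆ ∪ (arc r (suc a) L₁ ∪ arc r (suc a + L₁) L₂)  ≡⟨ ∪-assoc _ _ _ ⟨
    head ∪ arc r (suc a + L₁) L₂                              ≡⟨ cong (λ b → head ∪ arc r b L₂) (ℕ.+-suc a L₁) ⟨
    head ∪ arc r (a + suc L₁) L₂                              ∎
    where
    open ≡-Reasoning
    head = ⁅ a mod r ⁆ ∪ arc r (suc a) L₁

  arc-disjoint : ∀ {a L₁ L₂} → L₁ + L₂ ≤ r → Empty (arc r a L₁ ∩ arc r (a + L₁) L₂)
  arc-disjoint {a} {L₁} {L₂} L₁+L₂≤r (x , x∈∩) with x∈p∩q⁻ (arc r a L₁) _ x∈∩
  ... | x∈₁ , x∈₂ with ∈-arc⁻ x∈₁ | ∈-arc⁻ x∈₂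
  ... | i , i<L₁ , x≡i | j , j<L₂ , x≡j = >⇒∤ {{>-nonZero 0<k}} k<r ([m+n]%o≡m%o⇒o∣n (a + i) same)
    where
    k = L₁ + j ∸ i
    i<L₁+j : i < L₁ + j
    i<L₁+j = ℕ.<-≤-trans i<L₁ (ℕ.m≤m+n L₁ j)
    0<k : 0 < k
    0<k = ℕ.m<n⇒0<n∸m i<L₁+j
    k<r : k < r
    k<r = ℕ.≤-<-trans (ℕ.m∸n≤m (L₁ + j) i) (ℕ.<-≤-trans (ℕ.+-monoʳ-< L₁ j<L₂) L₁+L₂≤r)
    same : (a + i + k) % r ≡ (a + i) % r
    same = begin
      (a + i + k) % r    ≡⟨ cong (_% r) (ℕ.+-assoc a i k) ⟩
      (a + (i + k)) % r  ≡⟨ cong (λ z → (a + z) % r) (ℕ.m+[n∸m]≡n (ℕ.<⇒≤ i<L₁+j)) ⟩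
      (a + (L₁ + j)) % r ≡⟨ cong (_% r) (ℕ.+-assoc a L₁ j) ⟨
      (a + L₁ + j) % r   ≡⟨ x≡j ⟨
      toℕ x              ≡⟨ x≡i ⟩
      (a + i) % r        ∎
      where open ≡-Reasoning

  arc-head-disjoint : ∀ {a L} → suc L ≤ r → Empty (⁅ a mod r ⁆ ∩ arc r (suc a) L)
  arc-head-disjoint {a} {L} 1+L≤r (x , x∈∩) with x∈p∩q⁻ ⁅ a mod r ⁆ _ x∈∩
  ... | x∈⁅a⁆ , x∈arc = arc-disjoint {a = a} {L₁ = 1} 1+L≤r
    (x , x∈p∩q⁺ (x∈p∪q⁺ (inj₁ x∈⁅a⁆) , subst (λ b → x ∈ arc r b L) (ℕ.+-comm 1 a) x∈arc))

  arc-full : ∀ {a L} → r ≤ L → ∀ x → x ∈ arc r a L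
  arc-full {a} r≤L x = ∈-arc⁺ i (ℕ.<-≤-trans (m%n<n _ r) r≤L) (sym a+i≡x)
    where
    open ≡-Reasoning
    b = a % r
    X = toℕ x
    c = X + (r ∸ b)
    -- i represents x − a modulo r
    i = c % r
    a+i≡x : (a + i) % r ≡ X
    a+i≡x = begin
      (a + i) % r              ≡⟨ %-distribˡ-+ a i r ⟩
      (b + c % r % r) % r      ≡⟨ cong₂ (λ s t → (s + t) % r) (sym (m%n%n≡m%n a r)) (m%n%n≡m%n c r) ⟩
      (b % r + c % r) % r      ≡⟨ %-distribˡ-+ b c r ⟨
      (b + (X + (r ∸ b))) % r  ≡⟨ cong (_% r) (ℕ+.x∙yz≈y∙xz b X (r ∸ b)) ⟩
      (X + (b + (r ∸ b))) % r  ≡⟨ cong (λ z → (X + z) % r) (ℕ.m+[n∸m]≡n (ℕ.<⇒≤ (m%n<n a r))) ⟩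
      (X + r) % r              ≡⟨ [m+n]%n≡m%n X r ⟩
      X % r                    ≡⟨ m<n⇒m%n≡m (toℕ<n x) ⟩
      X                        ∎

multiples : ℕ → ℕ → ℕ → ℕ
multiples d a zero    = 0
multiples d a (suc L) with d ∣? a
... | yes _ = suc (multiples d (suc a) L)
... | no  _ = multiples d (suc a) L

multiples-≤ : ∀ d a L → multiples d a L ≤ L
multiples-≤ d a zero    = z≤n
multiples-≤ d a (suc L) with d ∣? a
... | yes _ = s≤s (multiples-≤ d (suc a) L)
... | no  _ = ℕ.m≤n⇒m≤1+n (multiples-≤ d (suc a) L)

multiples-+ : ∀ d a L₁ L₂ → multiples d a (L₁ + L₂) ≡ multiples d a L₁ + multiples d (a + L₁) L₂
multiples-+ d a zero     L₂ = cong (λ b → multiples d b L₂) (sym (ℕ.+-identityʳ a))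
multiples-+ d a (suc L₁) L₂ with d ∣? a
... | yes _ = cong suc (trans (multiples-+ d (suc a) L₁ L₂)
                    (cong (λ b → multiples d (suc a) L₁ + multiples d b L₂) (sym (ℕ.+-suc a L₁))))
... | no  _ = trans (multiples-+ d (suc a) L₁ L₂)
                    (cong (λ b → multiples d (suc a) L₁ + multiples d b L₂) (sym (ℕ.+-suc a L₁)))

multiples-mono : ∀ d a {L L′} → L ≤ L′ → multiples d a L ≤ multiples d a L′
multiples-mono d a {L} {L′} L≤L′ = begin
  multiples d a L                                      ≤⟨ ℕ.m≤m+n _ _ ⟩
  multiples d a L + multiples d (a + L) (L′ ∸ L)       ≡⟨ multiples-+ d a L (L′ ∸ L) ⟨
  multiples d a (L + (L′ ∸ L))                         ≡⟨ cong (multiples d a) (ℕ.m+[n∸m]≡n L≤L′) ⟩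
  multiples d a L′                                     ∎
  where open ℕ.≤-Reasoning

multiples-suc : ∀ d a L → multiples d a (suc L) ≡ multiples d a 1 + multiples d (suc a) L
multiples-suc d a L with d ∣? a
... | yes _ = refl
... | no  _ = refl

multiples-periodic : ∀ d a L → multiples d (a + d) L ≡ multiples d a L
multiples-periodic d a zero    = refl
multiples-periodic d a (suc L) with d ∣? a + d | d ∣? a
... | yes _   | yes _   = cong suc (multiples-periodic d (suc a) L)
... | no  _   | no  _   = multiples-periodic d (suc a) L
... | yes d∣a+d | no d∤a = ⊥-elim (d∤a (∣m+n∣m⇒∣n (subst (d ∣_) (ℕ.+-comm a d) d∣a+d) ∣-refl))
... | no d∤a+d | yes d∣a = ⊥-elim (d∤a+d (∣m∣n⇒∣m+n d∣a ∣-refl))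

-- Shifting a window of length d by one trades its first entry a for a + d.
multiples-rotate : ∀ d a → multiples d (suc a) d ≡ multiples d a d
multiples-rotate zero     a = refl
multiples-rotate (suc d′) a = begin
  multiples d (suc a) (suc d′)                        ≡⟨ cong (multiples d (suc a)) (ℕ.+-comm 1 d′) ⟩
  multiples d (suc a) (d′ + 1)                        ≡⟨ multiples-+ d (suc a) d′ 1 ⟩
  multiples d (suc a) d′ + multiples d (suc a + d′) 1 ≡⟨ cong (λ b → multiples d (suc a) d′ + multiples d b 1) (ℕ.+-suc a d′) ⟨
  multiples d (suc a) d′ + multiples d (a + d) 1      ≡⟨ cong (multiples d (suc a) d′ +_) (multiples-periodic d a 1) ⟩
  multiples d (suc a) d′ + multiples d a 1            ≡⟨ ℕ.+-comm (multiples d (suc a) d′) (multiples d a 1) ⟩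
  multiples d a 1 + multiples d (suc a) d′            ≡⟨ multiples-suc d a d′ ⟨
  multiples d a (suc d′)                              ∎
  where
  open ≡-Reasoning
  d = suc d′

multiples-below : ∀ d {a} L → 0 < a → a + L ≤ d → multiples d a L ≡ 0
multiples-below d zero    0<a a+L≤d = refl
multiples-below d {a} (suc L) 0<a a+L≤d with d ∣? a
... | yes d∣a = ⊥-elim (>⇒∤ {{>-nonZero 0<a}} (ℕ.<-≤-trans (ℕ.m<m+n a z<s) a+L≤d) d∣a)
... | no  _   = multiples-below d L z<s (subst (_≤ d) (ℕ.+-suc a L) a+L≤d)

module _ {d : ℕ} .{{_ : NonZero d}} where

  L≡q*d+t : ∀ L → L ≡ L / d * d + L % d
  L≡q*d+t L = trans (m≡m%n+[m/n]*n L d) (ℕ.+-comm (L % d) _)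

  multiples-window : ∀ a → multiples d a d ≡ 1
  multiples-window zero    = trans (cong (multiples d 0) (sym (ℕ.suc-pred d))) from-0
    where
    from-0 : multiples d 0 (suc (pred d)) ≡ 1
    from-0 with d ∣? 0
    ... | yes _   = cong suc (multiples-below d (pred d) z<s (ℕ.≤-reflexive (ℕ.suc-pred d)))
    ... | no d∤0 = ⊥-elim (d∤0 (d ∣0))
  multiples-window (suc a) = trans (multiples-rotate d a) (multiples-window a)

  multiples-periods : ∀ a q → multiples d a (q * d) ≡ q
  multiples-periods a zero    = refl
  multiples-periods a (suc q) = begin
    multiples d a (d + q * d)                        ≡⟨ multiples-+ d a d (q * d) ⟩
    multiples d a d + multiples d (a + d) (q * d)    ≡⟨ cong₂ _+_ (multiples-window a) (multiples-periods (a + d) q) ⟩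
    suc q                                            ∎
    where open ≡-Reasoning

  multiples-periods-+ : ∀ a q t → multiples d a (q * d + t) ≡ q + multiples d (a + q * d) t
  multiples-periods-+ a q t =
    trans (multiples-+ d a (q * d) t) (cong (_+ multiples d (a + q * d) t) (multiples-periods a q))

  L/d≤multiples : ∀ a L → L / d ≤ multiples d a L
  L/d≤multiples a L = begin
    L / d                                                  ≤⟨ ℕ.m≤m+n _ _ ⟩
    L / d + multiples d (a + L / d * d) (L % d)            ≡⟨ multiples-periods-+ a (L / d) (L % d) ⟨
    multiples d a (L / d * d + L % d)                      ≡⟨ cong (multiples d a) (L≡q*d+t L) ⟨
    multiples d a L                                        ∎
    where open ℕ.≤-Reasoning

  multiples-suc-≤ : ∀ a L → multiples d a (suc L) ≤ suc (L / d)
  multiples-suc-≤ a L = begin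
    multiples d a (suc L)                                  ≡⟨ cong (multiples d a) 1+L≡q*d+1+t ⟩
    multiples d a (L / d * d + suc (L % d))                ≡⟨ multiples-periods-+ a (L / d) (suc (L % d)) ⟩
    L / d + multiples d (a + L / d * d) (suc (L % d))      ≤⟨ ℕ.+-monoʳ-≤ (L / d) (multiples-mono d _ (m%n<n L d)) ⟩
    L / d + multiples d (a + L / d * d) d                  ≡⟨ cong (L / d +_) (multiples-window _) ⟩
    L / d + 1                                              ≡⟨ ℕ.+-comm (L / d) 1 ⟩
    suc (L / d)                                            ∎
    where
    open ℕ.≤-Reasoning
    1+L≡q*d+1+t : suc L ≡ L / d * d + suc (L % d)
    1+L≡q*d+1+t = trans (cong suc (L≡q*d+t L)) (sym (ℕ.+-suc (L / d * d) (L % d)))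

  multiples-longer-window : ∀ a b L → multiples d b (suc L) ≤ suc (multiples d a L)
  multiples-longer-window a b L = ℕ.≤-trans (multiples-suc-≤ b L) (s≤s (L/d≤multiples a L))

module _ {r d : ℕ} .{{_ : NonZero r}} .{{_ : NonZero d}} (d∣r : d ∣ r)
         (y : Fin r → ℚ) {α : ℚ} (0≤α : 0ℚ ≤ℚ α)
         (y-mult : ∀ x → d ∣ toℕ x → y x ≡ 0ℚ) (y-nonmult : ∀ x → ¬ d ∣ toℕ x → y x ≡ α) where

  y-nonNeg : ∀ x → 0ℚ ≤ℚ y x
  y-nonNeg x with d ∣? toℕ x
  ... | yes d∣x = ℚ.≤-reflexive (sym (y-mult x d∣x))
  ... | no  d∤x = subst (0ℚ ≤ℚ_) (sym (y-nonmult x d∤x)) 0≤α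

  ∣%⇒∣ : ∀ {a} → d ∣ a % r → d ∣ a
  ∣%⇒∣ {a} d∣a%r = m%n≡0⇒n∣m a d (trans (sym (m∣n⇒o%n%m≡o%m d r a d∣r)) (n∣m⇒m%n≡0 (a % r) d d∣a%r))

  ∣⇒∣% : ∀ {a} → d ∣ a → d ∣ a % r
  ∣⇒∣% {a} d∣a = m%n≡0⇒n∣m (a % r) d (trans (m∣n⇒o%n%m≡o%m d r a d∣r) (n∣m⇒m%n≡0 a d d∣a))

  ySum-arc-step : ∀ a L → y (a mod r) +ℚ (L ∸ multiples d (suc a) L) · α ≡ (suc L ∸ multiples d a (suc L)) · α
  ySum-arc-step a L with d ∣? a
  ... | yes d∣a = trans (cong (_+ℚ _) (y-mult _ (subst (d ∣_) (sym (toℕ-mod a)) (∣⇒∣% d∣a)))) (ℚ.+-identityˡ _)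
  ... | no  d∤a = trans (cong (_+ℚ _) (y-nonmult _ (d∤a ∘ ∣%⇒∣ ∘ subst (d ∣_) (toℕ-mod a))))
                        (cong (_· α) (sym (ℕ.+-∸-assoc 1 (multiples-≤ d (suc a) L))))

  ySum-arc : ∀ a L → L ≤ r → ySum y (arc r a L) ≡ (L ∸ multiples d a L) · α
  ySum-arc a zero    _     = ySum-⊥ y
  ySum-arc a (suc L) 1+L≤r = begin
    ySum y (⁅ a mod r ⁆ ∪ arc r (suc a) L)             ≡⟨ ySum-∪ y _ _ (arc-head-disjoint 1+L≤r) ⟩
    ySum y ⁅ a mod r ⁆ +ℚ ySum y (arc r (suc a) L)     ≡⟨ cong₂ _+ℚ_ (ySum-⁅⁆ y _) (ySum-arc (suc a) L (ℕ.<⇒≤ 1+L≤r)) ⟩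
    y (a mod r) +ℚ (L ∸ multiples d (suc a) L) · α     ≡⟨ ySum-arc-step a L ⟩
    (suc L ∸ multiples d a (suc L)) · α                ∎
    where open ≡-Reasoning

  ySum-arc-≤-longer : ∀ a b L → suc L ≤ r → ySum y (arc r a L) ≤ℚ ySum y (arc r b (suc L))
  ySum-arc-≤-longer a b L 1+L≤r = begin
    ySum y (arc r a L)                     ≡⟨ ySum-arc a L (ℕ.<⇒≤ 1+L≤r) ⟩
    (L ∸ multiples d a L) · α              ≤⟨ ·-monoˡ-≤ 0≤α (ℕ.∸-monoʳ-≤ (suc L) (multiples-longer-window a b L)) ⟩
    (suc L ∸ multiples d b (suc L)) · α    ≡⟨ ySum-arc b (suc L) 1+L≤r ⟨
    ySum y (arc r b (suc L))               ∎
    where open ℚ.≤-Reasoning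

  ySum-disjoint-arcs-≤ : ∀ u ℓ v s → Empty (arc r u ℓ ∩ arc r v s) →
    ySum y (arc r u ℓ) +ℚ ySum y (arc r v s) ≤ℚ ySum y (arc r u (ℓ + s + 1))
  ySum-disjoint-arcs-≤ u ℓ v s disjoint with ℓ + suc s ℕ.≤? r
  ... | yes ℓ+1+s≤r = begin
    ySum y (arc r u ℓ) +ℚ ySum y (arc r v s)               ≤⟨ ℚ.+-monoʳ-≤ (ySum y (arc r u ℓ)) (ySum-arc-≤-longer v (u + ℓ) s 1+s≤r) ⟩
    ySum y (arc r u ℓ) +ℚ ySum y (arc r (u + ℓ) (suc s))   ≡⟨ ySum-∪ y _ _ (arc-disjoint {L₂ = suc s} ℓ+1+s≤r) ⟨
    ySum y (arc r u ℓ ∪ arc r (u + ℓ) (suc s))             ≡⟨ cong (ySum y) (arc-+ u ℓ (suc s)) ⟨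
    ySum y (arc r u (ℓ + suc s))                           ≡⟨ cong (ySum y ∘ arc r u) (ℓ+s+1≡ℓ+1+s) ⟨
    ySum y (arc r u (ℓ + s + 1))                           ∎
    where
    open ℚ.≤-Reasoning
    1+s≤r : suc s ≤ r
    1+s≤r = ℕ.≤-trans (ℕ.m≤n+m (suc s) ℓ) ℓ+1+s≤r
    ℓ+s+1≡ℓ+1+s : ℓ + s + 1 ≡ ℓ + suc s
    ℓ+s+1≡ℓ+1+s = trans (ℕ.+-comm (ℓ + s) 1) (sym (ℕ.+-suc ℓ s))
  ... | no ℓ+1+s≰r = begin
    ySum y (arc r u ℓ) +ℚ ySum y (arc r v s)   ≡⟨ ySum-∪ y _ _ disjoint ⟨
    ySum y (arc r u ℓ ∪ arc r v s)             ≤⟨ ySum-mono-⊆ y y-nonNeg (λ {x} _ → arc-full r≤ℓ+s+1 x) ⟩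
    ySum y (arc r u (ℓ + s + 1))               ∎
    where
    open ℚ.≤-Reasoning
    r≤ℓ+s+1 : r ≤ ℓ + s + 1
    r≤ℓ+s+1 = ℕ.≤-trans (ℕ.<⇒≤ (ℕ.≰⇒> ℓ+1+s≰r)) (ℕ.≤-reflexive (trans (ℕ.+-suc ℓ s) (ℕ.+-comm 1 (ℓ + s))))

ySum-disjoint-intervals-≤ : ∀ {r d} .{{_ : NonZero d}} → d ∣ r → (y : Fin r → ℚ) → ∀ {α} → 0ℚ ≤ℚ α →
  (∀ x → d ∣ toℕ x → y x ≡ 0ℚ) → (∀ x → ¬ d ∣ toℕ x → y x ≡ α) →
  ∀ u ℓ v s → Disjoint (interval r u ℓ) (interval r v s) →
  ySum y (interval r u ℓ) +ℚ ySum y (interval r v s) ≤ℚ ySum y (interval r u (ℓ + s + 1))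
ySum-disjoint-intervals-≤ {zero}  _   _ _   _      _         _ _ _ _ _ = ℚ.≤-reflexive (ℚ.+-identityʳ 0ℚ)
ySum-disjoint-intervals-≤ {suc r} d∣r y 0≤α y-mult y-nonmult u ℓ v s disjoint
  rewrite interval≡arc r u ℓ | interval≡arc r v s | interval≡arc r u (ℓ + s + 1) =
  ySum-disjoint-arcs-≤ d∣r y 0≤α y-mult y-nonmult u ℓ v s disjoint

yW-mult : ∀ n d x → d ∣ toℕ x → yW n d x ≡ 0ℚ
yW-mult n d x d∣x with d ∣? toℕ x
... | yes _   = refl
... | no  d∤x = ⊥-elim (d∤x d∣x)

yW-nonmult : ∀ n d x → ¬ d ∣ toℕ x → yW n d x ≡ recip (divN (n ∸ 1) d * (d ∸ 1))
yW-nonmult n d x d∤x with d ∣? toℕ x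
... | yes d∣x = ⊥-elim (d∤x d∣x)
... | no  _   = refl

recip-nonNeg : ∀ m → 0ℚ ≤ℚ recip m
recip-nonNeg zero    = ℚ.≤-refl
recip-nonNeg (suc m) = ℚ.nonNegative⁻¹ _ {{ℚ.normalize-nonNeg 1 (suc m)}}

lemma3p3 : (k n : ℕ) → 2 ≤ k → 2 ^ k < n →
    1 < gcd (2 ^ k ∸ 2) (n ∸ 1) →
    (u ℓ v s : ℕ) →
    Disjoint (interval (n ∸ 1) u ℓ) (interval (n ∸ 1) v s) →
    (ySum (yW n (gcd (2 ^ k ∸ 2) (n ∸ 1))) (interval (n ∸ 1) u ℓ)
    +ℚ ySum (yW n (gcd (2 ^ k ∸ 2) (n ∸ 1))) (interval (n ∸ 1) v s))
    ≤ℚ ySum (yW n (gcd (2 ^ k ∸ 2) (n ∸ 1))) (interval (n ∸ 1) u (ℓ + s + 1))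
lemma3p3 k n _ _ 1<d =
  ySum-disjoint-intervals-≤ {{>-nonZero (ℕ.<-trans z<s 1<d)}} (gcd[m,n]∣n (2 ^ k ∸ 2) (n ∸ 1)) (yW n d)
    (recip-nonNeg (divN (n ∸ 1) d * (d ∸ 1))) (yW-mult n d) (yW-nonmult n d)
  where
  d = gcd (2 ^ k ∸ 2) (n ∸ 1)
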